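{- Let $\alpha$ be a permutation, and let $S=(q_1,p_1,q_2,p_2,\dots,q_k,p_k)$ be a staircase of $k$ steps in $\alpha$. Let $i\in\{2,3,\dots,k-1\}$, and let $(q'_i,p'_i,q'_{i+1})$ be a bypass of $q_i,p_i,q_{i+1}$ in $S$; let $S'$ be the staircase obtained from $S$ by replacing $q_i,p_i,q_{i+1}$ with $q'_i,p'_i,q'_{i+1}$, and write $p'_{i+1}$ for the $(i+1)$st inner bend of $S'$ (which equals $p_{i+1}$). Let $S''=(q''_1,p''_1,\dots,q''_k,p''_k)$ be a staircase of $k$ steps in $\alpha$ such that $p''_{i-1}=p_{i-1}$ and each of the $4k$ elements of $S''$ belongs to $S\cup S'$. Then $(q''_i,p''_i,q''_{i+1},p''_{i+1})$ is equal either to $(q_i,p_i,q_{i+1},p_{i+1})$ or to $(q'_i,p'_i,q'_{i+1},p'_{i+1})$.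
   Context: Let $\alpha=\alpha(1),\dots,\alpha(n)$ be a permutation. An element $\alpha(i)$ is above $\alpha(j)$ (and $\alpha(j)$ below $\alpha(i)$) if $\alpha(i)>\alpha(j)$; $\alpha(i)$ is left of $\alpha(j)$ (and $\alpha(j)$ right of $\alpha(i)$) if $i<j$. For disjoint sets $X,Y$ of elements, $X$ is above $Y$ if every element of $X$ is above every element of $Y$, and similarly for the other directions. An increase is a pair $(\alpha(i),\alpha(j))$ with $i<j$ and $\alpha(i)<\alpha(j)$. For a pair $p=(\alpha(i),\alpha(j))$ and another element $\alpha(l)$: $\alpha(l)$ is sandwiched by $p$ from below if $i<l<j$ and $\alpha(l)$ is above both elements of $p$; from above if $i<l<j$ and $\alpha(l)$ is below both elements of $p$; from the left if $\alpha(i)<\alpha(l)<\alpha(j)$ and $\alpha(l)$ is to the right of both elements of $p$; from the right if $\alpha(i)<\alpha(l)<\alpha(j)$ and $\alpha(l)$ is to the left of both elements of $p$. A set is sandwiched by $p$ in some direction if each of its elements is. A staircase of $k$ steps is a sequence $S=(q_1,p_1,q_2,p_2,\dots,q_k,p_k)$ of $2k$ pairwise disjoint increases such that: for every $i\in[k]$, $p_i$ is sandwiched by $q_i$ from the left, and for $i>1$, $q_i$ is sandwiched by $p_{i-1}$ from below; for every $i\in[k-1]$, $q_{i+1}$ is to the right of and above $q_i$, and $p_{i+1}$ is to the right of and above $p_i$. The $q_i$ are the outer bends and the $p_i$ the inner bends. For $i>1$, a bypass of $q_i,p_i,q_{i+1}$ in $S$ is a sequence of three increases $q'_i,p'_i,q'_{i+1}$,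 disjoint from $S$, such that the sequence obtained from $S$ by replacing $q_i,p_i,q_{i+1}$ by $q'_i,p'_i,q'_{i+1}$ is again a staircase of $k$ steps, and moreover $q_i$ is above and to the left of $q'_i$, $p_i$ is above and to the right of $p'_i$, and $q'_{i+1}$ is sandwiched by $q_{i+1}$ from the right. Bends are compared as ordered pairs of elements. -}

module Defs where

open import Data.Nat using (ℕ; zero; suc; _≡ᵇ_) renaming (_<_ to _<ℕ_; _≤_ to _≤ℕ_)
open import Data.Fin using (Fin) renaming (_<_ to _<ᶠ_)
open import Data.Fin.Permutation using (Permutation′; _⟨$⟩ʳ_)
open import Data.Product using (_×_; _,_; proj₁; proj₂)
open import Data.Bool using (if_then_else_)
open import Data.List using (List; []; _∷_; _++_; concatMap; map)
open import Data.List.Relation.Unary.Unique.Propositional using (Unique)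
open import Data.List.Membership.Propositional using (_∈_)
open import Data.List.Relation.Unary.All using (All)
open import Relation.Binary.PropositionalEquality using (_≡_)
open import Relation.Nullary using (¬_)

-- Elements of the permutation α(1..n) are identified with their positions
-- (Fin n); the value of the element at position x is α ⟨$⟩ʳ x.
Pair : ℕ → Set
Pair n = Fin n × Fin n

range1 : ℕ → List ℕ
range1 zero = []
range1 (suc k) = range1 k ++ (suc k ∷ [])

module _ {n : ℕ} (α : Permutation′ n) where

  Above : Fin n → Fin n → Set
  Above x y = (α ⟨$⟩ʳ y) <ᶠ (α ⟨$⟩ʳ x)

  LeftOf : Fin n → Fin n → Set
  LeftOf x y = x <ᶠ y

  Increase : Pair n → Set
  Increase (a , b) = LeftOf a b × Above b a

  elemsP : Pair n → List (Fin n)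
  elemsP (a , b) = a ∷ b ∷ []

  SandBelowE : Pair n → Fin n → Set
  SandBelowE (a , b) x = (LeftOf a x × LeftOf x b) × (Above x a × Above x b)

  SandAboveE : Pair n → Fin n → Set
  SandAboveE (a , b) x = (LeftOf a x × LeftOf x b) × (Above a x × Above b x)

  SandLeftE : Pair n → Fin n → Set
  SandLeftE (a , b) x = (Above x a × Above b x) × (LeftOf a x × LeftOf b x)

  SandRightE : Pair n → Fin n → Set
  SandRightE (a , b) x = (Above x a × Above b x) × (LeftOf x a × LeftOf x b)

  SandBelow SandAbove SandLeft SandRight : Pair n → Pair n → Set
  SandBelow p r = All (SandBelowE p) (elemsP r)
  SandAbove p r = All (SandAboveE p) (elemsP r)
  SandLeft p r = All (SandLeftE p) (elemsP r)
  SandRight p r = All (SandRightE p) (elemsP r)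

  AboveP : Pair n → Pair n → Set
  AboveP X Y = All (λ x → All (Above x) (elemsP Y)) (elemsP X)

  LeftOfP : Pair n → Pair n → Set
  LeftOfP X Y = All (λ x → All (LeftOf x) (elemsP Y)) (elemsP X)

  elemsS : ℕ → (ℕ → Pair n) → (ℕ → Pair n) → List (Fin n)
  elemsS k q p = concatMap (λ i → elemsP (q i) ++ elemsP (p i)) (range1 k)

  -- staircase of k steps, given by q i (outer bends) and p i (inner bends)
  -- for i = 1..k (values outside 1..k are irrelevant)
  record Staircase (k : ℕ) (q p : ℕ → Pair n) : Set where
    field
      incQ : ∀ i → 1 ≤ℕ i → i ≤ℕ k → Increase (q i)
      incP : ∀ i → 1 ≤ℕ i → i ≤ℕ k → Increase (p i)
      disjoint : Unique (elemsS k q p)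
      pLeft : ∀ i → 1 ≤ℕ i → i ≤ℕ k → SandLeft (q i) (p i)
      qBelow : ∀ i → 2 ≤ℕ i → i ≤ℕ k → SandBelow (p (i Data.Nat.∸ 1)) (q i)
      qStep : ∀ i → 1 ≤ℕ i → i <ℕ k →
                LeftOfP (q i) (q (suc i)) × AboveP (q (suc i)) (q i)
      pStep : ∀ i → 1 ≤ℕ i → i <ℕ k →
                LeftOfP (p i) (p (suc i)) × AboveP (p (suc i)) (p i)

  replQ : (ℕ → Pair n) → ℕ → Pair n → Pair n → ℕ → Pair n
  replQ q i a c j = if j ≡ᵇ i then a else (if j ≡ᵇ suc i then c else q j)

  replP : (ℕ → Pair n) → ℕ → Pair n → ℕ → Pair n
  replP p i b j = if j ≡ᵇ i then b else p j

  record Bypass (k : ℕ) (q p : ℕ → Pair n) (i : ℕ) (q'i p'i q'i1 : Pair n) : Set where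
    field
      disjS : All (λ x → ¬ (x ∈ elemsS k q p)) (elemsP q'i ++ elemsP p'i ++ elemsP q'i1)
      stair : Staircase k (replQ q i q'i q'i1) (replP p i p'i)
      qAboveLeft : AboveP (q i) q'i × LeftOfP (q i) q'i
      pAboveRight : AboveP (p i) p'i × LeftOfP p'i (p i)
      qRight : SandRight (q (suc i)) q'i1

module Submission where

-- Let i = m + 1 with m = i - 1 ≥ 1.  Sixteen elements matter: the two elements
-- of each of p_m, q_i, p_i, q_{i+1}, p_{i+1}, q'_i, p'_i, q'_{i+1}.  The
-- staircase axioms of S and S' and the bypass conditions order these points
-- completely from left to right and along two bottom-to-top chains; every
-- other element of S ∪ S' lies strictly below-left of the configuration
-- (the steps before i, including q_m) or strictly above-right of it (the
-- steps after i + 1).  Now S'' is forced step by step: q''_i is sandwiched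
-- from below by p''_m = p_m, and the only increases of such elements in that
-- region are q_i and q'_i; afterwards each bend of S'' is sandwiched by the
-- previous one, and each such region contains exactly one increase.

open import Defs
open import Data.Nat using (ℕ; zero; suc; _∸_; _≤_; _<_; z≤n; s≤s; _≡ᵇ_)
  renaming (_≟_ to _≟ℕ_)
open import Data.Nat.Properties
  using (<-cmp; 1+n≢n; n≤1+n; n<1+n; <⇒≢; m<n⇒m<1+n; ≤-pred; m≤n⇒m<n∨m≡n; m<1+n⇒m<n∨m≡n;
         ≤-refl; ≤-reflexive; ≤-trans; <-trans; <⇒≤; ≤⇒≯; ≤-<-trans; <-≤-trans)
import Data.Fin as Fin
open import Data.Fin using (Fin; toℕ; _≟_)
open import Data.Fin.Permutation using (Permutation′; _⟨$⟩ʳ_)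
open import Data.Bool using (Bool; true; false; T; not; _∧_; _∨_; if_then_else_)
open import Data.Bool.Properties using (T-∨; T-∧)
open import Data.Bool.ListAction using (any)
import Data.Product as Product
open import Data.Product using (_×_; _,_; proj₁; proj₂; Σ-syntax)
import Data.Sum as Sum
open import Data.Sum using (_⊎_; inj₁; inj₂; [_,_]′)
open import Data.Empty using (⊥-elim)
open import Data.List using (List; []; _∷_; _++_; filterᵇ; cartesianProduct; allFin; map)
open import Data.List.Membership.Propositional using (_∈_; find; lose)
open import Data.List.Membership.Propositional.Properties
  using (∈-filter⁺; ∈-allFin; ∈-cartesianProduct⁺; ∈-++⁻; ∈-++⁺ˡ; ∈-++⁺ʳ;
         ∈-concatMap⁻; ∈-concatMap⁺; ∈-map⁻)
open import Data.List.Relation.Unary.All using (All; []; _∷_)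
import Data.List.Relation.Unary.All as All
open import Data.List.Relation.Unary.Any using (here; there)
open import Data.List.Relation.Unary.AllPairs using (AllPairs; []; _∷_)
open import Data.List.Relation.Unary.Linked using (Linked; [-]; _∷_)
open import Data.List.Relation.Unary.Linked.Properties using (Linked⇒AllPairs)
open import Relation.Binary.PropositionalEquality
  using (_≡_; _≢_; refl; trans; cong; cong₂; subst; subst₂)
open import Relation.Binary.Definitions using (tri<; tri≈; tri>)
open import Relation.Nullary using (¬_; yes; no)
open import Relation.Nullary.Decidable using (⌊_⌋; toWitness)
open import Function using (_∘_; Equivalence)

T-∨⁻ : ∀ {b c} → T (b ∨ c) → T b ⊎ T c
T-∨⁻ = Equivalence.to T-∨

T-not⁺ : ∀ {b} → ¬ T b → T (not b)
T-not⁺ {false} _ = _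
T-not⁺ {true} ¬t = ¬t _

data Axis : Set where
  horizontal vertical : Axis

-- What is known about their order is
-- given, for each axis, by chains: lists of names that are strictly
-- increasing along that axis.  Besides the named points we allow points lying
-- strictly before 'lowCorner' on both axes and points lying strictly after
-- 'highCorner' on both axes.
module OrderConfiguration {N : ℕ}
  (chains : Axis → List (List (Fin N)))
  (lowCorner highCorner : Axis → Fin N) where

  open import Data.List.Membership.DecPropositional (_≟_ {N}) using (_∈?_)

  precedes : List (Fin N) → Fin N → Fin N → Bool
  precedes []       u v = false
  precedes (w ∷ ws) u v = (⌊ w ≟ u ⌋ ∧ ⌊ v ∈? ws ⌋) ∨ precedes ws u v

  precedes-sound : ∀ {R : Fin N → Fin N → Set} {ws u v} → AllPairs R ws → T (precedes ws u v) → R u v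
  precedes-sound {ws = w ∷ ws} {u} {v} (w≺ws ∷ ws↗) t with T-∨⁻ t
  ... | inj₂ later = precedes-sound ws↗ later
  ... | inj₁ now with Equivalence.to T-∧ now
  ...   | w≡u , v∈ws with toWitness {a? = w ≟ u} w≡u
  ...     | refl = All.lookup w≺ws (toWitness {a? = v ∈? ws} v∈ws)

  knownBelow : Axis → Fin N → Fin N → Bool
  knownBelow κ u v = any (λ ch → precedes ch u v) (chains κ)

  knownAtMost : Axis → Fin N → Fin N → Bool
  knownAtMost κ u v = ⌊ u ≟ v ⌋ ∨ knownBelow κ u v

  -- The sandwich region of (lo , hi): strictly between lo and hi along one
  -- axis and beyond both of them across it.  'belowBox' is "sandwiched from
  -- below", 'leftBox' is "sandwiched from the left".
  record Box : Set where
    constructor box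
    field
      along across : Axis
      lo hi : Fin N

  belowBox leftBox : Fin N → Fin N → Box
  belowBox = box horizontal vertical
  leftBox  = box vertical horizontal

  excludes : Box → Fin N → Bool
  excludes (box κ μ lo hi) u =
    knownAtMost κ u lo ∨ knownAtMost κ hi u ∨ knownAtMost μ u lo ∨ knownAtMost μ u hi

  -- no point beyond the corners lies in the region
  excludesFar : Box → Bool
  excludesFar (box κ μ lo hi) = knownAtMost κ (lowCorner κ) lo ∧ knownAtMost κ hi (highCorner κ)

  candidates : Box → List (Fin N)
  candidates B = filterᵇ (not ∘ excludes B) (allFin N)

  excludesIncrease : Fin N × Fin N → Bool
  excludesIncrease (u , v) = knownAtMost horizontal v u ∨ knownAtMost vertical v u

  bends : Box → List (Fin N × Fin N)
  bends B = filterᵇ (not ∘ excludesIncrease) (cartesianProduct (candidates B) (candidates B))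

  module Realisation {E : Set} (coord : Axis → E → ℕ) (pt : Fin N → E)
    (chainsValid : ∀ κ → All (Linked (λ u v → coord κ (pt u) < coord κ (pt v))) (chains κ)) where

    knownBelow-sound : ∀ κ {u v} → T (knownBelow κ u v) → coord κ (pt u) < coord κ (pt v)
    knownBelow-sound κ = sound (chainsValid κ)
      where
      sound : ∀ {u v chs} → All (Linked (λ u v → coord κ (pt u) < coord κ (pt v))) chs →
              T (any (λ ch → precedes ch u v) chs) → coord κ (pt u) < coord κ (pt v)
      sound (ch ∷ chs) t =
        [ precedes-sound (Linked⇒AllPairs <-trans ch) , sound chs ]′ (T-∨⁻ t)

    knownAtMost-sound : ∀ κ {u v} → T (knownAtMost κ u v) → coord κ (pt u) ≤ coord κ (pt v)
    knownAtMost-sound κ {u} {v} t with T-∨⁻ t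
    ... | inj₁ u≡v = ≤-reflexive (cong (coord κ ∘ pt) (toWitness {a? = u ≟ v} u≡v))
    ... | inj₂ u<v = <⇒≤ (knownBelow-sound κ u<v)

    -- x lies in the region; for belowBox/leftBox this is SandBelowE/SandLeftE of Defs
    InBox : Box → E → Set
    InBox (box κ μ lo hi) x =
      (coord κ (pt lo) < coord κ x × coord κ x < coord κ (pt hi)) ×
      (coord μ (pt lo) < coord μ x × coord μ (pt hi) < coord μ x)

    data Located (x : E) : Set where
      named   : (u : Fin N) → x ≡ pt u → Located x
      farLow  : (∀ κ → coord κ x < coord κ (pt (lowCorner κ))) → Located x
      farHigh : (∀ κ → coord κ (pt (highCorner κ)) < coord κ x) → Located x

    named-∈ : ∀ {x us} → x ∈ map pt us → Located x
    named-∈ x∈ with ∈-map⁻ pt x∈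
    ... | u , _ , refl = named u refl

    excluded-outside : ∀ B u → T (excludes B u) → ¬ InBox B (pt u)
    excluded-outside (box κ μ lo hi) u t ((lo<u , u<hi) , (lo<u′ , hi<u′)) with T-∨⁻ t
    ... | inj₁ u≤lo = ≤⇒≯ (knownAtMost-sound κ u≤lo) lo<u
    ... | inj₂ t′ with T-∨⁻ t′
    ...   | inj₁ hi≤u = ≤⇒≯ (knownAtMost-sound κ hi≤u) u<hi
    ...   | inj₂ t″ with T-∨⁻ t″
    ...     | inj₁ u≤lo′ = ≤⇒≯ (knownAtMost-sound μ u≤lo′) lo<u′
    ...     | inj₂ u≤hi′ = ≤⇒≯ (knownAtMost-sound μ u≤hi′) hi<u′

    inBox⇒candidate : ∀ B {x} → T (excludesFar B) → Located x → InBox B x →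
                      Σ[ u ∈ Fin N ] u ∈ candidates B × x ≡ pt u
    inBox⇒candidate B far (named u refl) inB =
      u , ∈-filter⁺ _ (∈-allFin u) (T-not⁺ (λ t → excluded-outside B u t inB)) , refl
    inBox⇒candidate (box κ μ lo hi) far (farLow x<low) ((lo<x , _) , _) =
      ⊥-elim (≤⇒≯ (knownAtMost-sound κ (proj₁ (Equivalence.to T-∧ far)))
                  (<-trans lo<x (x<low κ)))
    inBox⇒candidate (box κ μ lo hi) far (farHigh high<x) ((_ , x<hi) , _) =
      ⊥-elim (≤⇒≯ (knownAtMost-sound κ (proj₂ (Equivalence.to T-∧ far)))
                  (<-trans (high<x κ) x<hi))

    bendInBox : ∀ B {x y} → T (excludesFar B) → Located x → Located y →
                InBox B x → InBox B y →
                coord horizontal x < coord horizontal y → coord vertical x < coord vertical y →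
                Σ[ uv ∈ Fin N × Fin N ] uv ∈ bends B × (x , y) ≡ (pt (proj₁ uv) , pt (proj₂ uv))
    bendInBox B far locX locY inX inY x<ₕy x<ᵥy
      with inBox⇒candidate B far locX inX | inBox⇒candidate B far locY inY
    ... | u , u∈ , refl | v , v∈ , refl =
      (u , v) , ∈-filter⁺ _ (∈-cartesianProduct⁺ u∈ v∈) (T-not⁺ notExcluded) , refl
      where
      notExcluded : ¬ T (excludesIncrease (u , v))
      notExcluded t with T-∨⁻ t
      ... | inj₁ v≤ₕu = ≤⇒≯ (knownAtMost-sound horizontal v≤ₕu) x<ₕy
      ... | inj₂ v≤ᵥu = ≤⇒≯ (knownAtMost-sound vertical v≤ᵥu) x<ᵥy

    onlyBend : ∀ B {w z} {r : E × E} → bends B ≡ (w , z) ∷ [] →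
               Σ[ uv ∈ Fin N × Fin N ] uv ∈ bends B × r ≡ (pt (proj₁ uv) , pt (proj₂ uv)) →
               r ≡ (pt w , pt z)
    onlyBend B only (uv , uv∈ , r≡) with subst (uv ∈_) only uv∈
    ... | here refl = r≡

first : ∀ {A : Set} {P : A → Set} {x y} → All P (x ∷ y ∷ []) → P x
first (px ∷ _) = px

second : ∀ {A : Set} {P : A → Set} {x y} → All P (x ∷ y ∷ []) → P y
second (_ ∷ py ∷ []) = py

entry₁₁ : ∀ {A : Set} {R : A → A → Set} {x₁ x₂ y₁ y₂} →
          All (λ x → All (R x) (y₁ ∷ y₂ ∷ [])) (x₁ ∷ x₂ ∷ []) → R x₁ y₁
entry₁₁ = first ∘ first

entry₁₂ : ∀ {A : Set} {R : A → A → Set} {x₁ x₂ y₁ y₂} →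
          All (λ x → All (R x) (y₁ ∷ y₂ ∷ [])) (x₁ ∷ x₂ ∷ []) → R x₁ y₂
entry₁₂ = second ∘ first

entry₂₁ : ∀ {A : Set} {R : A → A → Set} {x₁ x₂ y₁ y₂} →
          All (λ x → All (R x) (y₁ ∷ y₂ ∷ [])) (x₁ ∷ x₂ ∷ []) → R x₂ y₁
entry₂₁ = first ∘ second

interlaced : ∀ {k} (f g : ℕ → ℕ) →
              (∀ {j} → 1 ≤ j → j ≤ k → f j ≤ g j) →
              (∀ {j} → 1 ≤ j → j < k → g j < f (suc j)) →
              ∀ {j l} → 1 ≤ j → j < l → l ≤ k → g j < f l
interlaced f g f≤g g<f {j} {suc l} 1≤j j<1+l 1+l≤k with m<1+n⇒m<n∨m≡n j<1+l
... | inj₂ refl = g<f 1≤j 1+l≤k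
... | inj₁ j<l = <-trans (<-≤-trans (interlaced f g f≤g g<f 1≤j j<l (<⇒≤ 1+l≤k))
                                    (f≤g 1≤l (<⇒≤ 1+l≤k)))
                         (g<f 1≤l 1+l≤k)
  where
  1≤l : 1 ≤ l
  1≤l = ≤-trans 1≤j (<⇒≤ j<l)

module StaircaseGeometry {n : ℕ} (α : Permutation′ n) where

  coordinate : Axis → Fin n → ℕ
  coordinate horizontal x = toℕ x
  coordinate vertical   x = toℕ (α ⟨$⟩ʳ x)

  P V : Fin n → ℕ
  P = coordinate horizontal
  V = coordinate vertical

  stepElems : (q p : ℕ → Pair n) → ℕ → List (Fin n)
  stepElems q p j = elemsP α (q j) ++ elemsP α (p j)

  ∈-range1⁻ : ∀ {j} k → j ∈ range1 k → 1 ≤ j × j ≤ k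
  ∈-range1⁻ (suc k) j∈ with ∈-++⁻ (range1 k) j∈
  ... | inj₁ j∈′ = Product.map₂ (λ j≤k → ≤-trans j≤k (n≤1+n k)) (∈-range1⁻ k j∈′)
  ... | inj₂ (here refl) = s≤s z≤n , ≤-refl

  ∈-range1⁺ : ∀ {j k} → 1 ≤ j → j ≤ k → j ∈ range1 k
  ∈-range1⁺ {k = zero} (s≤s _) ()
  ∈-range1⁺ {j} {suc k} 1≤j j≤1+k with m≤n⇒m<n∨m≡n j≤1+k
  ... | inj₁ j<1+k = ∈-++⁺ˡ (∈-range1⁺ 1≤j (≤-pred j<1+k))
  ... | inj₂ refl  = ∈-++⁺ʳ (range1 k) (here refl)

  ∈-elemsS⁻ : ∀ {k q p x} → x ∈ elemsS α k q p →
              Σ[ j ∈ ℕ ] (1 ≤ j × j ≤ k) × x ∈ stepElems q p j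
  ∈-elemsS⁻ {k} {q} {p} x∈ with find (∈-concatMap⁻ (stepElems q p) x∈)
  ... | j , j∈ , x∈j = j , ∈-range1⁻ k j∈ , x∈j

  ∈-elemsS⁺ : ∀ {k q p j x} → 1 ≤ j → j ≤ k → x ∈ stepElems q p j → x ∈ elemsS α k q p
  ∈-elemsS⁺ {q = q} {p} 1≤j j≤k x∈ = ∈-concatMap⁺ (stepElems q p) (lose (∈-range1⁺ 1≤j j≤k) x∈)

  module _ {k : ℕ} {q p : ℕ → Pair n} (S : Staircase α k q p) where
    open Staircase S

    stepBounds : ∀ {j x} → 1 ≤ j → j ≤ k → x ∈ stepElems q p j →
                 (P (proj₁ (q j)) ≤ P x × P x ≤ P (proj₂ (p j))) ×
                 (V (proj₁ (q j)) ≤ V x × V x ≤ V (proj₂ (q j)))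
    stepBounds {j} 1≤j j≤k x∈ with incQ j 1≤j j≤k | incP j 1≤j j≤k | pLeft j 1≤j j≤k
    ... | q₁<ₕq₂ , q₁<ᵥq₂ | p₁<ₕp₂ , p₁<ᵥp₂
        | ((q₁<ᵥp₁ , p₁<ᵥq₂) , (q₁<ₕp₁ , q₂<ₕp₁)) ∷ ((q₁<ᵥp₂ , p₂<ᵥq₂) , (q₁<ₕp₂ , q₂<ₕp₂)) ∷ []
        with x∈
    ... | here refl =
      (≤-refl , <⇒≤ (<-trans q₁<ₕq₂ q₂<ₕp₂)) , (≤-refl , <⇒≤ q₁<ᵥq₂)
    ... | there (here refl) =
      (<⇒≤ q₁<ₕq₂ , <⇒≤ q₂<ₕp₂) , (<⇒≤ q₁<ᵥq₂ , ≤-refl)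
    ... | there (there (here refl)) =
      (<⇒≤ q₁<ₕp₁ , <⇒≤ p₁<ₕp₂) , (<⇒≤ q₁<ᵥp₁ , <⇒≤ p₁<ᵥq₂)
    ... | there (there (there (here refl))) =
      (<⇒≤ q₁<ₕp₂ , ≤-refl) , (<⇒≤ q₁<ᵥp₂ , <⇒≤ p₂<ᵥq₂)

    outerBendsRise : ∀ {j l} → 1 ≤ j → j < l → l ≤ k → V (proj₂ (q j)) < V (proj₁ (q l))
    outerBendsRise = interlaced (λ j → V (proj₁ (q j))) (λ j → V (proj₂ (q j)))
      (λ 1≤j j≤k → <⇒≤ (proj₂ (incQ _ 1≤j j≤k)))
      (λ 1≤j j<k → entry₁₂ (proj₂ (qStep _ 1≤j j<k)))

    earlierSteps : ∀ {j l x} → 1 ≤ j → j < l → l ≤ k → x ∈ stepElems q p j →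
                   P x < P (proj₁ (p l)) × V x < V (proj₁ (q l))
    earlierSteps {j} {l} {x} 1≤j j<l l≤k x∈ =
      ≤-<-trans (proj₂ (proj₁ bounds)) innerBendsAdvance ,
      ≤-<-trans (proj₂ (proj₂ bounds)) (outerBendsRise 1≤j j<l l≤k)
      where
      bounds : (P (proj₁ (q j)) ≤ P x × P x ≤ P (proj₂ (p j))) ×
               (V (proj₁ (q j)) ≤ V x × V x ≤ V (proj₂ (q j)))
      bounds = stepBounds 1≤j (≤-trans (<⇒≤ j<l) l≤k) x∈
      innerBendsAdvance : P (proj₂ (p j)) < P (proj₁ (p l))
      innerBendsAdvance = interlaced (λ j → P (proj₁ (p j))) (λ j → P (proj₂ (p j)))
        (λ 1≤j j≤k → <⇒≤ (proj₁ (incP _ 1≤j j≤k)))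
        (λ 1≤j j<k → entry₂₁ (proj₁ (pStep _ 1≤j j<k)))
        1≤j j<l l≤k

    laterSteps : ∀ {l j x} → 1 ≤ l → l < j → j ≤ k → x ∈ stepElems q p j →
                 P (proj₁ (p l)) < P x × V (proj₂ (q l)) < V x
    laterSteps {l} {j} {x} 1≤l l<j j≤k x∈ =
      <-≤-trans outerBendsFollowInner (proj₁ (proj₁ bounds)) ,
      <-≤-trans (outerBendsRise 1≤l l<j j≤k) (proj₁ (proj₂ bounds))
      where
      bounds : (P (proj₁ (q j)) ≤ P x × P x ≤ P (proj₂ (p j))) ×
               (V (proj₁ (q j)) ≤ V x × V x ≤ V (proj₂ (q j)))
      bounds = stepBounds (≤-trans 1≤l (<⇒≤ l<j)) j≤k x∈
      outerBendsFollowInner : P (proj₁ (p l)) < P (proj₁ (q j))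
      outerBendsFollowInner = interlaced (λ j → P (proj₁ (q j))) (λ j → P (proj₁ (p j)))
        (λ 1≤j j≤k → <⇒≤ (proj₁ (proj₂ (first (pLeft _ 1≤j j≤k)))))
        (λ 1≤j j<k → proj₁ (proj₁ (first (qBelow _ (s≤s 1≤j) j<k))))
        1≤l l<j j≤k

-- The sixteen points of the argument, named after the staircase elements:
-- (c₀ , d₀) = p_{i-1}, (a , b) = q_i, (c , d) = p_i, (e , f) = q_{i+1},
-- (g , h) = p_{i+1}, (a′ , b′) = q'_i, (c′ , d′) = p'_i, (e′ , f′) = q'_{i+1}.
module BypassShape where

  pattern c₀ = Fin.zero
  pattern d₀ = Fin.suc c₀
  pattern a  = Fin.suc d₀
  pattern b  = Fin.suc a
  pattern c  = Fin.suc b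
  pattern d  = Fin.suc c
  pattern e  = Fin.suc d
  pattern f  = Fin.suc e
  pattern g  = Fin.suc f
  pattern h  = Fin.suc g
  pattern a′ = Fin.suc h
  pattern b′ = Fin.suc a′
  pattern c′ = Fin.suc b′
  pattern d′ = Fin.suc c′
  pattern e′ = Fin.suc d′
  pattern f′ = Fin.suc e′

  Name : Set
  Name = Fin 16

  -- Their left-to-right order, and two bottom-to-top chains (nothing is
  -- known about the relative values of e′, f′ and g, h).
  chains : Axis → List (List Name)
  chains horizontal =
    (c₀ ∷ a ∷ b ∷ a′ ∷ b′ ∷ d₀ ∷ c′ ∷ e′ ∷ f′ ∷ d′ ∷ c ∷ e ∷ f ∷ d ∷ g ∷ h ∷ []) ∷ []
  chains vertical =
    (c₀ ∷ d₀ ∷ a′ ∷ c′ ∷ d′ ∷ b′ ∷ a ∷ c ∷ d ∷ b ∷ e ∷ e′ ∷ f′ ∷ f ∷ []) ∷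
    (c₀ ∷ d₀ ∷ a′ ∷ c′ ∷ d′ ∷ b′ ∷ a ∷ c ∷ d ∷ b ∷ e ∷ g ∷ h ∷ f ∷ []) ∷ []

  -- the other elements of S ∪ S' lie left of c₀ and below a′, or right of g
  -- and above f
  lowCorner highCorner : Axis → Name
  lowCorner horizontal = c₀
  lowCorner vertical   = a′
  highCorner horizontal = g
  highCorner vertical   = f

  open OrderConfiguration chains lowCorner highCorner public

  below-c₀d₀ : bends (belowBox c₀ d₀) ≡ (a , b) ∷ (a′ , b′) ∷ []
  below-c₀d₀ = refl

  left-ab : bends (leftBox a b) ≡ (c , d) ∷ []
  left-ab = refl

  below-cd : bends (belowBox c d) ≡ (e , f) ∷ []
  below-cd = refl

  left-ef : bends (leftBox e f) ≡ (g , h) ∷ []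
  left-ef = refl

  left-a′b′ : bends (leftBox a′ b′) ≡ (c′ , d′) ∷ []
  left-a′b′ = refl

  below-c′d′ : bends (belowBox c′ d′) ≡ (e′ , f′) ∷ []
  below-c′d′ = refl

  left-e′f′ : bends (leftBox e′ f′) ≡ (g , h) ∷ []
  left-e′f′ = refl

if-≡ᵇ-same : ∀ {A : Set} m {x y : A} → (if m ≡ᵇ m then x else y) ≡ x
if-≡ᵇ-same zero    = refl
if-≡ᵇ-same (suc m) = if-≡ᵇ-same m

if-≡ᵇ-diff : ∀ {A : Set} {m n} {x y : A} → m ≢ n → (if m ≡ᵇ n then x else y) ≡ y
if-≡ᵇ-diff {m = zero}  {zero}  m≢n = ⊥-elim (m≢n refl)
if-≡ᵇ-diff {m = zero}  {suc n} _   = refl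
if-≡ᵇ-diff {m = suc m} {zero}  _   = refl
if-≡ᵇ-diff {m = suc m} {suc n} m≢n = if-≡ᵇ-diff (m≢n ∘ cong suc)

module Replacement {n : ℕ} (α : Permutation′ n) where

  replQ-at : ∀ q j (x z : Pair n) → replQ α q j x z j ≡ x
  replQ-at q j x z = if-≡ᵇ-same j

  replQ-next : ∀ q j (x z : Pair n) → replQ α q j x z (suc j) ≡ z
  replQ-next q j x z = trans (if-≡ᵇ-diff (1+n≢n {j})) (if-≡ᵇ-same (suc j))

  replQ-other : ∀ q j (x z : Pair n) {l} → l ≢ j → l ≢ suc j → replQ α q j x z l ≡ q l
  replQ-other q j x z l≢j l≢1+j = trans (if-≡ᵇ-diff l≢j) (if-≡ᵇ-diff l≢1+j)

  replP-at : ∀ p j (y : Pair n) → replP α p j y j ≡ y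
  replP-at p j y = if-≡ᵇ-same j

  replP-other : ∀ p j (y : Pair n) {l} → l ≢ j → replP α p j y l ≡ p l
  replP-other p j y l≢j = if-≡ᵇ-diff l≢j

module BypassRealisation {n : ℕ} {α : Permutation′ n} {k : ℕ} {q p : ℕ → Pair n}
  (S : Staircase α k q p) (m′ : ℕ) (i<k : suc (suc m′) < k)
  {A B C : Pair n} (bypass : Bypass α k q p (suc (suc m′)) A B C) where

  open StaircaseGeometry α
  open Replacement α
  open BypassShape
  open Bypass bypass
  module S = Staircase S
  module S′ = Staircase stair

  m i : ℕ
  m = suc m′
  i = suc m

  q′ p′ : ℕ → Pair n
  q′ = replQ α q i A C
  p′ = replP α p i B

  1≤m : 1 ≤ m
  1≤m = s≤s z≤n
  m<k : m < k
  m<k = <⇒≤ i<k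
  m≤k : m ≤ k
  m≤k = <⇒≤ m<k
  1≤i : 1 ≤ i
  1≤i = s≤s z≤n
  2≤i : 2 ≤ i
  2≤i = s≤s (s≤s z≤n)
  i≤k : i ≤ k
  i≤k = <⇒≤ i<k
  1≤1+i : 1 ≤ suc i
  1≤1+i = s≤s z≤n
  2≤1+i : 2 ≤ suc i
  2≤1+i = s≤s (s≤s z≤n)

  m≢i : m ≢ i
  m≢i = <⇒≢ (n<1+n m)
  m≢1+i : m ≢ suc i
  m≢1+i = <⇒≢ (m<n⇒m<1+n (n<1+n m))

  pt : Name → Fin n
  pt c₀ = proj₁ (p m)
  pt d₀ = proj₂ (p m)
  pt a  = proj₁ (q i)
  pt b  = proj₂ (q i)
  pt c  = proj₁ (p i)
  pt d  = proj₂ (p i)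
  pt e  = proj₁ (q (suc i))
  pt f  = proj₂ (q (suc i))
  pt g  = proj₁ (p (suc i))
  pt h  = proj₂ (p (suc i))
  pt a′ = proj₁ A
  pt b′ = proj₂ A
  pt c′ = proj₁ B
  pt d′ = proj₂ B
  pt e′ = proj₁ C
  pt f′ = proj₂ C

  S′-q-i : Increase α A
  S′-q-i = subst (Increase α) (replQ-at q i A C) (S′.incQ i 1≤i i≤k)
  S′-p-i : Increase α B
  S′-p-i = subst (Increase α) (replP-at p i B) (S′.incP i 1≤i i≤k)
  S′-q-1+i : Increase α C
  S′-q-1+i = subst (Increase α) (replQ-next q i A C) (S′.incQ (suc i) 1≤1+i i<k)
  S′-below-i : SandBelow α (p m) A
  S′-below-i = subst₂ (SandBelow α) (replP-other p i B m≢i) (replQ-at q i A C) (S′.qBelow i 2≤i i≤k)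
  S′-left-i : SandLeft α A B
  S′-left-i = subst₂ (SandLeft α) (replQ-at q i A C) (replP-at p i B) (S′.pLeft i 1≤i i≤k)
  S′-below-1+i : SandBelow α B C
  S′-below-1+i = subst₂ (SandBelow α) (replP-at p i B) (replQ-next q i A C) (S′.qBelow (suc i) 2≤1+i i<k)
  S′-innerStep-m : LeftOfP α (p m) B
  S′-innerStep-m = subst₂ (LeftOfP α) (replP-other p i B m≢i) (replP-at p i B) (proj₁ (S′.pStep m 1≤m m<k))
  S′-outerStep-m : AboveP α A (q m)
  S′-outerStep-m = subst₂ (AboveP α) (replQ-at q i A C) (replQ-other q i A C m≢i m≢1+i) (proj₂ (S′.qStep m 1≤m m<k))

  Increasing : Axis → Name → Name → Set
  Increasing κ u v = coordinate κ (pt u) < coordinate κ (pt v)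

  horizontalChain : Linked (Increasing horizontal)
    (c₀ ∷ a ∷ b ∷ a′ ∷ b′ ∷ d₀ ∷ c′ ∷ e′ ∷ f′ ∷ d′ ∷ c ∷ e ∷ f ∷ d ∷ g ∷ h ∷ [])
  horizontalChain =
      proj₁ (proj₁ (first (S.qBelow i 2≤i i≤k)))
    ∷ proj₁ (S.incQ i 1≤i i≤k)
    ∷ entry₂₁ (proj₂ qAboveLeft)
    ∷ proj₁ S′-q-i
    ∷ proj₂ (proj₁ (second S′-below-i))
    ∷ entry₂₁ S′-innerStep-m
    ∷ proj₁ (proj₁ (first S′-below-1+i))
    ∷ proj₁ S′-q-1+i
    ∷ proj₂ (proj₁ (second S′-below-1+i))
    ∷ entry₂₁ (proj₂ pAboveRight)
    ∷ proj₁ (proj₁ (first (S.qBelow (suc i) 2≤1+i i<k)))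
    ∷ proj₁ (S.incQ (suc i) 1≤1+i i<k)
    ∷ proj₂ (proj₁ (second (S.qBelow (suc i) 2≤1+i i<k)))
    ∷ entry₂₁ (proj₁ (S.pStep i 1≤i i<k))
    ∷ proj₁ (S.incP (suc i) 1≤1+i i<k)
    ∷ [-]

  verticalUpTo-e : ∀ {rest} → Linked (Increasing vertical) (e ∷ rest) →
    Linked (Increasing vertical) (c₀ ∷ d₀ ∷ a′ ∷ c′ ∷ d′ ∷ b′ ∷ a ∷ c ∷ d ∷ b ∷ e ∷ rest)
  verticalUpTo-e fromE =
      proj₂ (S.incP m 1≤m m≤k)
    ∷ proj₂ (proj₂ (first S′-below-i))
    ∷ proj₁ (proj₁ (first S′-left-i))
    ∷ proj₂ S′-p-i
    ∷ proj₂ (proj₁ (second S′-left-i))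
    ∷ entry₁₂ (proj₁ qAboveLeft)
    ∷ proj₁ (proj₁ (first (S.pLeft i 1≤i i≤k)))
    ∷ proj₂ (S.incP i 1≤i i≤k)
    ∷ proj₂ (proj₁ (second (S.pLeft i 1≤i i≤k)))
    ∷ entry₁₂ (proj₂ (S.qStep i 1≤i i<k))
    ∷ fromE

  chainsValid : ∀ κ → All (Linked (Increasing κ)) (chains κ)
  chainsValid horizontal = horizontalChain ∷ []
  chainsValid vertical =
      verticalUpTo-e ( proj₁ (proj₁ (first qRight))
                     ∷ proj₂ S′-q-1+i
                     ∷ proj₂ (proj₁ (second qRight))
                     ∷ [-])
    ∷ verticalUpTo-e ( proj₁ (proj₁ (first (S.pLeft (suc i) 1≤1+i i<k)))
                     ∷ proj₂ (S.incP (suc i) 1≤1+i i<k)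
                     ∷ proj₂ (proj₁ (second (S.pLeft (suc i) 1≤1+i i<k)))
                     ∷ [-])
    ∷ []

  open Realisation coordinate pt chainsValid public

  beforeBypass : ∀ {x} → P x < P (pt c₀) → V x < V (pt a′) → Located x
  beforeBypass x<ₕc₀ x<ᵥa′ = farLow λ { horizontal → x<ₕc₀ ; vertical → x<ᵥa′ }

  locatedStep-m : ∀ {x} → x ∈ stepElems q p m → Located x
  locatedStep-m (here refl) =
    beforeBypass (proj₁ (proj₂ (first (S.pLeft m 1≤m m≤k)))) (entry₁₁ S′-outerStep-m)
  locatedStep-m (there (here refl)) =
    beforeBypass (proj₂ (proj₂ (first (S.pLeft m 1≤m m≤k)))) (entry₁₂ S′-outerStep-m)
  locatedStep-m (there (there x∈)) = named-∈ {us = c₀ ∷ d₀ ∷ []} x∈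

  -- steps before m lie below-left, steps m, i, i + 1 consist of named points
  -- (apart from q m, which lies below-left), later steps lie above-right
  locatedS : ∀ {j x} → 1 ≤ j → j ≤ k → x ∈ stepElems q p j → Located x
  locatedS {j} {x} 1≤j j≤k x∈ with <-cmp j m
  ... | tri< j<m _ _ =
    beforeBypass (proj₁ early) (<-trans (proj₂ early) (entry₁₁ S′-outerStep-m))
    where
    early : P x < P (pt c₀) × V x < V (proj₁ (q m))
    early = earlierSteps S 1≤j j<m m≤k x∈
  ... | tri≈ _ refl _ = locatedStep-m x∈
  ... | tri> _ _ i≤j with m≤n⇒m<n∨m≡n i≤j
  ...   | inj₂ refl = named-∈ {us = a ∷ b ∷ c ∷ d ∷ []} x∈
  ...   | inj₁ i<j with m≤n⇒m<n∨m≡n i<j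
  ...     | inj₂ refl = named-∈ {us = e ∷ f ∷ g ∷ h ∷ []} x∈
  ...     | inj₁ 1+i<j = farHigh λ { horizontal → proj₁ late ; vertical → proj₂ late }
    where
    late : P (pt g) < P x × V (pt f) < V x
    late = laterSteps S 1≤1+i 1+i<j j≤k x∈

  sameStep : ∀ {x r r′ s s′} → r ≡ r′ → s ≡ s′ →
             x ∈ elemsP α r ++ elemsP α s → x ∈ elemsP α r′ ++ elemsP α s′
  sameStep refl refl x∈ = x∈

  locatedS′ : ∀ {j x} → 1 ≤ j → j ≤ k → x ∈ stepElems q′ p′ j → Located x
  locatedS′ {j} 1≤j j≤k x∈ with j ≟ℕ i
  ... | yes refl = named-∈ {us = a′ ∷ b′ ∷ c′ ∷ d′ ∷ []}
                     (sameStep (replQ-at q i A C) (replP-at p i B) x∈)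
  ... | no j≢i with j ≟ℕ suc i
  ...   | yes refl = named-∈ {us = e′ ∷ f′ ∷ g ∷ h ∷ []}
                       (sameStep (replQ-next q i A C) (replP-other p i B 1+n≢n) x∈)
  ...   | no j≢1+i = locatedS 1≤j j≤k
                       (sameStep (replQ-other q i A C j≢i j≢1+i) (replP-other p i B j≢i) x∈)

  locatedSteps : ∀ {q₀ p₀ x} → (∀ {j y} → 1 ≤ j → j ≤ k → y ∈ stepElems q₀ p₀ j → Located y) →
                 x ∈ elemsS α k q₀ p₀ → Located x
  locatedSteps locatedStep x∈ with ∈-elemsS⁻ x∈
  ... | j , (1≤j , j≤k) , x∈j = locatedStep 1≤j j≤k x∈j

  located : ∀ {x} → x ∈ elemsS α k q p ++ elemsS α k q′ p′ → Located x
  located x∈ = [ locatedSteps locatedS , locatedSteps locatedS′ ]′ (∈-++⁻ (elemsS α k q p) x∈)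

  module Tracing {q″ p″ : ℕ → Pair n} (S″ : Staircase α k q″ p″)
    (within : All (λ x → x ∈ (elemsS α k q p ++ elemsS α k q′ p′)) (elemsS α k q″ p″)) where
    module S″ = Staircase S″

    locatedS″ : ∀ {j x} → 1 ≤ j → j ≤ k → x ∈ stepElems q″ p″ j → Located x
    locatedS″ 1≤j j≤k x∈ = located (All.lookup within (∈-elemsS⁺ 1≤j j≤k x∈))

    outerBendIn : ∀ {j} Bx → T (excludesFar Bx) → 1 ≤ j → j ≤ k →
                  All (InBox Bx) (elemsP α (q″ j)) →
                  Σ[ uv ∈ Name × Name ] uv ∈ bends Bx × q″ j ≡ (pt (proj₁ uv) , pt (proj₂ uv))
    outerBendIn {j} Bx far 1≤j j≤k inBox =
      bendInBox Bx far (locatedS″ 1≤j j≤k (here refl)) (locatedS″ 1≤j j≤k (there (here refl)))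
        (first inBox) (second inBox) (proj₁ (S″.incQ j 1≤j j≤k)) (proj₂ (S″.incQ j 1≤j j≤k))

    innerBendIn : ∀ {j} Bx → T (excludesFar Bx) → 1 ≤ j → j ≤ k →
                  All (InBox Bx) (elemsP α (p″ j)) →
                  Σ[ uv ∈ Name × Name ] uv ∈ bends Bx × p″ j ≡ (pt (proj₁ uv) , pt (proj₂ uv))
    innerBendIn {j} Bx far 1≤j j≤k inBox =
      bendInBox Bx far (locatedS″ 1≤j j≤k (there (there (here refl))))
        (locatedS″ 1≤j j≤k (there (there (there (here refl)))))
        (first inBox) (second inBox) (proj₁ (S″.incP j 1≤j j≤k)) (proj₂ (S″.incP j 1≤j j≤k))

    innerForced : ∀ {j} u v {w z} → 1 ≤ j → j ≤ k → q″ j ≡ (pt u , pt v) →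
                  bends (leftBox u v) ≡ (w , z) ∷ [] → T (excludesFar (leftBox u v)) →
                  p″ j ≡ (pt w , pt z)
    innerForced {j} u v 1≤j j≤k q″≡ only far =
      onlyBend (leftBox u v) only (innerBendIn (leftBox u v) far 1≤j j≤k
        (subst (λ r → SandLeft α r (p″ j)) q″≡ (S″.pLeft j 1≤j j≤k)))

    outerForced : ∀ {j} u v {w z} → 2 ≤ j → j ≤ k → p″ (j ∸ 1) ≡ (pt u , pt v) →
                  bends (belowBox u v) ≡ (w , z) ∷ [] → T (excludesFar (belowBox u v)) →
                  q″ j ≡ (pt w , pt z)
    outerForced {j} u v 2≤j j≤k p″≡ only far =
      onlyBend (belowBox u v) only (outerBendIn (belowBox u v) far (≤-trans (s≤s z≤n) 2≤j) j≤k
        (subst (λ r → SandBelow α r (q″ j)) p″≡ (S″.qBelow j 2≤j j≤k)))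

    firstOuterBend : p″ m ≡ p m → q″ i ≡ q i ⊎ q″ i ≡ A
    firstOuterBend p″≡ with outerBendIn (belowBox c₀ d₀) _ 1≤i i≤k
                              (subst (λ r → SandBelow α r (q″ i)) p″≡ (S″.qBelow i 2≤i i≤k))
    ... | uv , uv∈ , q″≡ with subst (uv ∈_) below-c₀d₀ uv∈
    ...   | here refl = inj₁ q″≡
    ...   | there (here refl) = inj₂ q″≡

lemma1 : ∀ {n} (α : Permutation′ n) (k : ℕ) (q p : ℕ → Pair n) →
    Staircase α k q p →
    (i : ℕ) → 2 ≤ i → i < k →
    (q'i p'i q'i1 : Pair n) → Bypass α k q p i q'i p'i q'i1 →
    (q'' p'' : ℕ → Pair n) → Staircase α k q'' p'' →
    p'' (i ∸ 1) ≡ p (i ∸ 1) →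
    All (λ x → x ∈ (elemsS α k q p ++ elemsS α k (replQ α q i q'i q'i1) (replP α p i p'i)))
    (elemsS α k q'' p'') →
    ((q'' i , p'' i , q'' (suc i) , p'' (suc i)) ≡ (q i , p i , q (suc i) , p (suc i)))
    ⊎ ((q'' i , p'' i , q'' (suc i) , p'' (suc i)) ≡ (q'i , p'i , q'i1 , p (suc i)))
lemma1 α k q p S (suc (suc m′)) (s≤s (s≤s z≤n)) i<k A B C bypass q″ p″ S″ p″≡ within =
  Sum.map alongS alongS′ (firstOuterBend p″≡)
  where
  open BypassShape
  open BypassRealisation S m′ i<k bypass
  open Tracing S″ within

  alongS : q″ i ≡ q i → (q″ i , p″ i , q″ (suc i) , p″ (suc i)) ≡ (q i , p i , q (suc i) , p (suc i))
  alongS q″ᵢ≡ = cong₂ _,_ q″ᵢ≡ (cong₂ _,_ p″ᵢ≡ (cong₂ _,_ q″ᵢ₊₁≡ p″ᵢ₊₁≡))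
    where
    p″ᵢ≡ : p″ i ≡ p i
    q″ᵢ₊₁≡ : q″ (suc i) ≡ q (suc i)
    p″ᵢ₊₁≡ : p″ (suc i) ≡ p (suc i)
    p″ᵢ≡ = innerForced a b 1≤i i≤k q″ᵢ≡ left-ab _
    q″ᵢ₊₁≡ = outerForced c d 2≤1+i i<k p″ᵢ≡ below-cd _
    p″ᵢ₊₁≡ = innerForced e f 1≤1+i i<k q″ᵢ₊₁≡ left-ef _

  alongS′ : q″ i ≡ A → (q″ i , p″ i , q″ (suc i) , p″ (suc i)) ≡ (A , B , C , p (suc i))
  alongS′ q″ᵢ≡ = cong₂ _,_ q″ᵢ≡ (cong₂ _,_ p″ᵢ≡ (cong₂ _,_ q″ᵢ₊₁≡ p″ᵢ₊₁≡))
    where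
    p″ᵢ≡ : p″ i ≡ B
    q″ᵢ₊₁≡ : q″ (suc i) ≡ C
    p″ᵢ₊₁≡ : p″ (suc i) ≡ p (suc i)
    p″ᵢ≡ = innerForced a′ b′ 1≤i i≤k q″ᵢ≡ left-a′b′ _
    q″ᵢ₊₁≡ = outerForced c′ d′ 2≤1+i i<k p″ᵢ≡ below-c′d′ _
    p″ᵢ₊₁≡ = innerForced e′ f′ 1≤1+i i<k q″ᵢ₊₁≡ left-e′f′ _
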